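{- Let $M\in\mathbb Z^{m\times n}$. Then $M$ is minimum (with respect to the row-lex ordering) if and only if for every $i=1,\ldots,m$ the submatrix consisting of the first $i$ rows of $M$ is minimum.
   Context: On $\mathbb Z^n$ use the lexicographic order. The row-lex ordering on $\mathbb Z^{p\times n}$ is the lexicographic extension of this order, viewing a matrix as the sequence of its rows. Two matrices of the same size are H-equivalent if one is obtained from the other by permuting and negating rows and columns. A matrix is minimum if it is the smallest element, in the row-lex ordering, of its H-equivalence class. -}

module Defs where

open import Data.Nat using (ℕ; zero; suc; _≤_)
open import Data.Integer using (ℤ; -_) renaming (_<_ to _<ℤ_)
open import Data.Fin using (Fin; zero; suc; inject≤)
open import Data.Fin.Permutation using (Permutation′; _⟨$⟩ʳ_)
open import Data.Sign using (Sign)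
open import Data.Product using (Σ; _×_; ∃)
open import Data.Sum using (_⊎_)
open import Data.Empty using (⊥)
open import Data.Unit using (⊤)
open import Relation.Binary.PropositionalEquality using (_≡_)

Vecℤ : ℕ → Set
Vecℤ n = Fin n → ℤ

Mat : ℕ → ℕ → Set
Mat p n = Fin p → Fin n → ℤ

_≋_ : ∀ {n} → Vecℤ n → Vecℤ n → Set
x ≋ y = ∀ j → x j ≡ y j

_≋M_ : ∀ {p n} → Mat p n → Mat p n → Set
A ≋M B = ∀ i → A i ≋ B i

_<lex_ : ∀ {n} → Vecℤ n → Vecℤ n → Set
_<lex_ {zero}  x y = ⊥
_<lex_ {suc n} x y = (x zero <ℤ y zero)
                   ⊎ ((x zero ≡ y zero) × ((λ j → x (suc j)) <lex (λ j → y (suc j))))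

_≤rowlex_ : ∀ {p n} → Mat p n → Mat p n → Set
_≤rowlex_ {zero}  A B = ⊤
_≤rowlex_ {suc p} A B = (A zero <lex B zero)
                      ⊎ ((A zero ≋ B zero) × ((λ i → A (suc i)) ≤rowlex (λ i → B (suc i))))

applySign : Sign → ℤ → ℤ
applySign Sign.+ x = x
applySign Sign.- x = - x

HEquiv : ∀ {p n} → Mat p n → Mat p n → Set
HEquiv {p} {n} A B =
  Σ (Permutation′ p) λ σ → Σ (Permutation′ n) λ τ →
  Σ (Fin p → Sign) λ r → Σ (Fin n → Sign) λ c →
  ∀ i j → B i j ≡ applySign (r i) (applySign (c j) (A (σ ⟨$⟩ʳ i) (τ ⟨$⟩ʳ j)))

IsMinimum : ∀ {p n} → Mat p n → Set
IsMinimum A = ∀ B → HEquiv A B → A ≤rowlex B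

firstRows : ∀ {m n} (i : ℕ) → i ≤ m → Mat m n → Mat i n
firstRows i i≤m M k = M (inject≤ k i≤m)

{-# OPTIONS --safe #-}
module Submission where

-- Only the forward direction has content. An H-equivalence of the first p rows of M extends
-- to one of M that fixes the last row (its row permutation fixes the last index, and that row
-- keeps its sign). Minimality of M then compares M with the extended matrix, and since
-- row-lex order is lexicographic in the rows, the comparison restricts to the first p rows.
-- Iterating, every prefix of a minimum matrix is minimum.

open import Defs
open import Data.Nat using (ℕ; zero; suc; _≤_; z≤n; s≤s)
open import Data.Nat.Properties using (n≤1+n; ≤-refl; m≤n⇒m<n∨m≡n)
open import Data.Fin using (Fin; zero; suc; inject≤; fromℕ; punchIn)
open import Data.Fin.Properties using (inject≤-refl; inject≤-idempotent)
open import Data.Fin.Permutation using (Permutation′; _⟨$⟩ʳ_; insert; insert-punchIn)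
open import Data.Integer using () renaming (_<_ to _<ℤ_)
open import Data.Sign using (Sign)
open import Data.Product using (Σ; _×_; _,_)
open import Data.Sum using (inj₁; inj₂)
open import Data.Unit using (tt)
open import Function using (_∘_)
open import Function.Bundles using (_⇔_; mk⇔)
open import Relation.Binary.PropositionalEquality
  using (_≡_; refl; sym; trans; cong; cong₂; subst₂; module ≡-Reasoning)

private
  variable
    p n : ℕ

snoc : ∀ {a} {A : Set a} → (Fin p → A) → A → Fin (suc p) → A
snoc {zero}  f x _       = x
snoc {suc p} f x zero    = f zero
snoc {suc p} f x (suc i) = snoc (f ∘ suc) x i

snoc-inject≤ : ∀ {a} {A : Set a} (f : Fin p → A) (x : A) (k : Fin p) .(p≤1+p : p ≤ suc p) →
               snoc f x (inject≤ k p≤1+p) ≡ f k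
snoc-inject≤ f x zero    _ = refl
snoc-inject≤ f x (suc k) _ = snoc-inject≤ (f ∘ suc) x k (n≤1+n _)

punchIn-fromℕ : (k : Fin p) .(p≤1+p : p ≤ suc p) → punchIn (fromℕ p) k ≡ inject≤ k p≤1+p
punchIn-fromℕ zero    _ = refl
punchIn-fromℕ (suc k) _ = cong suc (punchIn-fromℕ k (n≤1+n _))

insert-fromℕ-inject≤ : (σ : Permutation′ p) (k : Fin p) →
                       insert (fromℕ p) (fromℕ p) σ ⟨$⟩ʳ inject≤ k (n≤1+n p)
                         ≡ inject≤ (σ ⟨$⟩ʳ k) (n≤1+n p)
insert-fromℕ-inject≤ {p} σ k = begin
  insert (fromℕ p) (fromℕ p) σ ⟨$⟩ʳ inject≤ k _
    ≡⟨ cong (insert (fromℕ p) (fromℕ p) σ ⟨$⟩ʳ_) (sym (punchIn-fromℕ k _)) ⟩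
  insert (fromℕ p) (fromℕ p) σ ⟨$⟩ʳ punchIn (fromℕ p) k
    ≡⟨ insert-punchIn (fromℕ p) (fromℕ p) σ k ⟩
  punchIn (fromℕ p) (σ ⟨$⟩ʳ k)
    ≡⟨ punchIn-fromℕ (σ ⟨$⟩ʳ k) _ ⟩
  inject≤ (σ ⟨$⟩ʳ k) _ ∎
  where open ≡-Reasoning

<lex-resp-≋ : {a a′ b b′ : Vecℤ n} → a ≋ a′ → b ≋ b′ → a <lex b → a′ <lex b′
<lex-resp-≋ {suc n} a≋ b≋ (inj₁ a₀<b₀) = inj₁ (subst₂ _<ℤ_ (a≋ zero) (b≋ zero) a₀<b₀)
<lex-resp-≋ {suc n} a≋ b≋ (inj₂ (a₀≡b₀ , a<b)) =
  inj₂ ( trans (sym (a≋ zero)) (trans a₀≡b₀ (b≋ zero))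
       , <lex-resp-≋ (a≋ ∘ suc) (b≋ ∘ suc) a<b)

≤rowlex-resp-≋M : {A A′ B B′ : Mat p n} → A ≋M A′ → B ≋M B′ → A ≤rowlex B → A′ ≤rowlex B′
≤rowlex-resp-≋M {zero}  _  _  _ = tt
≤rowlex-resp-≋M {suc p} A≋ B≋ (inj₁ A₀<B₀) = inj₁ (<lex-resp-≋ (A≋ zero) (B≋ zero) A₀<B₀)
≤rowlex-resp-≋M {suc p} A≋ B≋ (inj₂ (A₀≋B₀ , A≤B)) =
  inj₂ ( (λ j → trans (sym (A≋ zero j)) (trans (A₀≋B₀ j) (B≋ zero j)))
       , ≤rowlex-resp-≋M (A≋ ∘ suc) (B≋ ∘ suc) A≤B)

HEquiv-respˡ-≋M : {A A′ B : Mat p n} → A ≋M A′ → HEquiv A′ B → HEquiv A B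
HEquiv-respˡ-≋M A≋ (σ , τ , r , c , B≡) =
  σ , τ , r , c , λ i j →
    trans (B≡ i j) (cong (applySign (r i) ∘ applySign (c j)) (sym (A≋ _ _)))

IsMinimum-resp-≋M : {A A′ : Mat p n} → A ≋M A′ → IsMinimum A → IsMinimum A′
IsMinimum-resp-≋M A≋ minA B A′~B =
  ≤rowlex-resp-≋M A≋ (λ _ _ → refl) (minA B (HEquiv-respˡ-≋M A≋ A′~B))

firstRows-mono : ∀ {m} i (i≤m : i ≤ m) {M N : Mat m n} →
                 M ≤rowlex N → firstRows i i≤m M ≤rowlex firstRows i i≤m N
firstRows-mono zero    _         _ = tt
firstRows-mono (suc i) (s≤s i≤m) (inj₁ M₀<N₀)        = inj₁ M₀<N₀
firstRows-mono (suc i) (s≤s i≤m) (inj₂ (M₀≋N₀ , M≤N)) = inj₂ (M₀≋N₀ , firstRows-mono i i≤m M≤N)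

firstRows-all : ∀ {m} (m≤m : m ≤ m) (M : Mat m n) → firstRows m m≤m M ≋M M
firstRows-all m≤m M i j = cong (λ k → M k j) (inject≤-refl i m≤m)

firstRows-firstRows : ∀ {i j m} (i≤j : i ≤ j) (j≤m : j ≤ m) (i≤m : i ≤ m) (M : Mat m n) →
                      firstRows i i≤j (firstRows j j≤m M) ≋M firstRows i i≤m M
firstRows-firstRows i≤j j≤m i≤m M k j = cong (λ l → M l j) (inject≤-idempotent k i≤j j≤m i≤m)

dropLastRow : Mat (suc p) n → Mat p n
dropLastRow {p} = firstRows p (n≤1+n p)

HEquiv-dropLastRow-lift : (M : Mat (suc p) n) {B : Mat p n} → HEquiv (dropLastRow M) B →
                          Σ (Mat (suc p) n) λ B′ → HEquiv M B′ × dropLastRow B′ ≋M B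
HEquiv-dropLastRow-lift {p} M {B} (σ , τ , r , c , B≡) =
  B′ , (σ′ , τ , r′ , c , λ _ _ → refl) , dropLastRow-B′
  where
  σ′ : Permutation′ (suc p)
  σ′ = insert (fromℕ p) (fromℕ p) σ

  r′ : Fin (suc p) → Sign
  r′ = snoc r Sign.+

  B′ : Mat (suc p) _
  B′ i j = applySign (r′ i) (applySign (c j) (M (σ′ ⟨$⟩ʳ i) (τ ⟨$⟩ʳ j)))

  dropLastRow-B′ : dropLastRow B′ ≋M B
  dropLastRow-B′ k j = begin
    dropLastRow B′ k j
      ≡⟨ cong₂ (λ s l → applySign s (applySign (c j) (M l (τ ⟨$⟩ʳ j))))
               (snoc-inject≤ r Sign.+ k _) (insert-fromℕ-inject≤ σ k) ⟩
    applySign (r k) (applySign (c j) (dropLastRow M (σ ⟨$⟩ʳ k) (τ ⟨$⟩ʳ j)))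
      ≡⟨ sym (B≡ k j) ⟩
    B k j ∎
    where open ≡-Reasoning

IsMinimum-dropLastRow : (M : Mat (suc p) n) → IsMinimum M → IsMinimum (dropLastRow M)
IsMinimum-dropLastRow {p} M minM B M′~B with HEquiv-dropLastRow-lift M M′~B
... | B′ , M~B′ , B′≋B =
  ≤rowlex-resp-≋M (λ _ _ → refl) B′≋B (firstRows-mono p (n≤1+n p) {M} {B′} (minM B′ M~B′))

IsMinimum-firstRows : ∀ {m} (M : Mat m n) → IsMinimum M →
                      ∀ i (i≤m : i ≤ m) → IsMinimum (firstRows i i≤m M)
IsMinimum-firstRows {m = m} M minM i i≤m with m≤n⇒m<n∨m≡n i≤m
... | inj₂ refl = IsMinimum-resp-≋M (λ k j → sym (firstRows-all i≤m M k j)) minM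
IsMinimum-firstRows {m = suc m} M minM i i≤1+m | inj₁ (s≤s i≤m) =
  IsMinimum-resp-≋M (firstRows-firstRows i≤m (n≤1+n m) i≤1+m M)
    (IsMinimum-firstRows (dropLastRow M) (IsMinimum-dropLastRow M minM) i i≤m)

lemma3p5 : ∀ {m n} (M : Mat m n) →
    IsMinimum M ⇔ (∀ (i : ℕ) (1≤i : 1 ≤ i) (i≤m : i ≤ m) → IsMinimum (firstRows i i≤m M))
lemma3p5 M = mk⇔ (λ minM i _ → IsMinimum-firstRows M minM i) (prefixes⇒IsMinimum M)
  where
  prefixes⇒IsMinimum : ∀ {m n} (M : Mat m n) →
    (∀ (i : ℕ) (1≤i : 1 ≤ i) (i≤m : i ≤ m) → IsMinimum (firstRows i i≤m M)) → IsMinimum M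
  prefixes⇒IsMinimum {zero}  M _        _ _ = tt
  prefixes⇒IsMinimum {suc m} M minFirst   =
    IsMinimum-resp-≋M (firstRows-all ≤-refl M) (minFirst (suc m) (s≤s z≤n) ≤-refl)
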